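{- Let $r\ge 1$ and let $G$ be a graph with at least one edge and $\Delta(G)\le r$. If every cluster of $G$ is dischargeable, then the average of $w(e)$ over all edges $e$ of $G$ is at most $r-2$.
   Context: For an edge $xy$ of $G$, $w(xy)=|N(x)\cap N(y)|$. An edge is tight if $w(xy)=r-1$; a tight clique is a clique all of whose edges are tight; a cluster is a maximal tight clique with at least two vertices. For a cluster $T$ with $t=|T|$, let $S=\bigcap_{x\in T}N(x)$, $s=|S|$, and let $R$ be the graph on $S$ whose edges are the pairs of $S$ non-adjacent in $G$. The cluster $T$ is dischargeable if $2e(R)\ge s+t-1$ (equivalently $\sum_{v\in S}(d_R(v)-1)\ge t-1$). -}

module Defs where

open import Data.Nat using (ℕ; zero; suc; _+_; _*_; _∸_; _≤_; _<ᵇ_)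
open import Data.Bool using (Bool; true; false; if_then_else_; _∧_; not; _∨_)
open import Data.Fin using (Fin; zero; suc; toℕ)
open import Data.Fin.Subset using (Subset; _∈_; _⊆_; ∣_∣)
open import Data.Vec using (lookup)
open import Data.Product using (_×_; Σ; ∃; ∃-syntax)
open import Relation.Binary.PropositionalEquality using (_≡_; _≢_)
open import Function using (_∘_)

countF : ∀ {n} → (Fin n → Bool) → ℕ
countF {zero}  p = 0
countF {suc n} p = (if p zero then 1 else 0) + countF (p ∘ suc)

sumF : ∀ {n} → (Fin n → ℕ) → ℕ
sumF {zero}  f = 0
sumF {suc n} f = f zero + sumF (f ∘ suc)

allF : ∀ {n} → (Fin n → Bool) → Bool
allF {zero}  p = true
allF {suc n} p = p zero ∧ allF (p ∘ suc)

record Graph (n : ℕ) : Set where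
  field
    adj   : Fin n → Fin n → Bool
    sym   : ∀ x y → adj x y ≡ adj y x
    irrefl : ∀ x → adj x x ≡ false

module _ {n : ℕ} (G : Graph n) where
  open Graph G

  deg : Fin n → ℕ
  deg x = countF (adj x)

  w : Fin n → Fin n → ℕ
  w x y = countF (λ z → adj x z ∧ adj y z)

  isEdge< : Fin n → Fin n → Bool
  isEdge< x y = (toℕ x <ᵇ toℕ y) ∧ adj x y

  numEdges : ℕ
  numEdges = sumF (λ x → countF (isEdge< x))

  sumW : ℕ
  sumW = sumF (λ x → sumF (λ y → if isEdge< x y then w x y else 0))

  HasEdge : Set
  HasEdge = ∃[ x ] ∃[ y ] adj x y ≡ true

  MaxDegreeAtMost : ℕ → Set
  MaxDegreeAtMost r = ∀ x → deg x ≤ r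

  Tight : ℕ → Fin n → Fin n → Set
  Tight r x y = adj x y ≡ true × w x y ≡ r ∸ 1

  TightClique : ℕ → Subset n → Set
  TightClique r T = ∀ x y → x ∈ T → y ∈ T → x ≢ y → Tight r x y

  Cluster : ℕ → Subset n → Set
  Cluster r T = TightClique r T
              × (∀ T′ → TightClique r T′ → T ⊆ T′ → T′ ⊆ T)
              × 2 ≤ ∣ T ∣

  -- v ∈ S = ⋂_{x ∈ T} N(x)
  inS : Subset n → Fin n → Bool
  inS T v = allF (λ x → not (lookup T x) ∨ adj x v)

  sSize : Subset n → ℕ
  sSize T = countF (inS T)

  eR : Subset n → ℕ
  eR T = sumF (λ u → countF (λ v →
           (toℕ u <ᵇ toℕ v) ∧ inS T u ∧ inS T v ∧ not (adj u v)))

  Dischargeable : Subset n → Set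
  Dischargeable T = sSize T + ∣ T ∣ ∸ 1 ≤ 2 * eR T

-- Count Σ_x Σ_{u ∈ N(x)} (w(xu) + 2) = 2 (Σ_e w(e) + 2 e(G)) vertex by vertex: it suffices that
-- each x has Σ_{u ∈ N(x)} (w(xu) + 2) ≤ r d(x).  If x lies on no tight edge, every term is at most r.
-- Otherwise d(x) = r, and x together with its tight neighbours is a cluster T of pairwise twins.
-- For u ∈ N(x) we have w(xu) + 1 + m(u) = d(x), where m(u) counts the neighbours v ≠ u of x
-- not adjacent to u, so the bound reduces to d(x) ≤ Σ_u m(u).  Since N(x) ⊆ S ∪ (T ∖ {x}),
-- d(x) ≤ s + t − 1 ≤ 2 e(R) by dischargeability, and 2 e(R) ≤ Σ_u m(u) because S ⊆ N(x).

module Submission where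

open import Defs
import Data.Bool as Bool
open import Data.Bool using (Bool; true; false; if_then_else_; _∧_; _∨_; not)
open import Data.Bool.Properties using (∧-comm; ∧-identityʳ; ∧-zeroʳ; ∨-identityʳ; ∨-zeroʳ)
open import Data.Empty using (⊥-elim)
open import Data.Fin using (Fin; zero; suc; toℕ; _≟_)
open import Data.Fin.Properties using (toℕ-injective; any?)
open import Data.Fin.Subset using (Subset; _∈_; _⊆_; ∣_∣)
open import Data.Nat using (ℕ; zero; suc; _+_; _*_; _∸_; _≤_; _<_; _<ᵇ_; z≤n; s≤s)
open import Data.Nat.Properties hiding (_≟_)
open import Data.Nat.Properties using () renaming (_≟_ to _≟ℕ_)
open import Algebra.Properties.CommutativeSemigroup +-commutativeSemigroup using (interchange)
open import Data.Product using (_×_; _,_; proj₁)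
open import Data.Sum using (_⊎_; inj₁; inj₂)
open import Data.Vec using (lookup; tabulate)
open import Data.Vec.Properties using (lookup∘tabulate; []=⇒lookup; lookup⇒[]=)
open import Function using (_∘_)
open import Relation.Nullary using (¬_; Dec; yes; no; does; _×-dec_; contradiction)
open import Relation.Nullary.Decidable using (dec-true; dec-false)
open import Relation.Nullary.Reflects using (ofʸ; ofⁿ)
open import Relation.Binary.PropositionalEquality

-- Finite sums and counts over Fin n

sumF-cong : ∀ {n} {f g : Fin n → ℕ} → (∀ i → f i ≡ g i) → sumF f ≡ sumF g
sumF-cong {zero}  f≗g = refl
sumF-cong {suc n} f≗g = cong₂ _+_ (f≗g zero) (sumF-cong (f≗g ∘ suc))

sumF-zero : ∀ n → sumF {n} (λ _ → 0) ≡ 0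
sumF-zero zero    = refl
sumF-zero (suc n) = sumF-zero n

sumF-+ : ∀ {n} (f g : Fin n → ℕ) → sumF (λ i → f i + g i) ≡ sumF f + sumF g
sumF-+ {zero}  f g = refl
sumF-+ {suc n} f g = trans (cong (f zero + g zero +_) (sumF-+ (f ∘ suc) (g ∘ suc)))
                           (interchange (f zero) (g zero) _ _)

sumF-mono-≤ : ∀ {n} {f g : Fin n → ℕ} → (∀ i → f i ≤ g i) → sumF f ≤ sumF g
sumF-mono-≤ {zero}  f≤g = z≤n
sumF-mono-≤ {suc n} f≤g = +-mono-≤ (f≤g zero) (sumF-mono-≤ (f≤g ∘ suc))

sumF-* : ∀ {n} c (f : Fin n → ℕ) → sumF (λ i → c * f i) ≡ c * sumF f
sumF-* {zero}  c f = sym (*-zeroʳ c)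
sumF-* {suc n} c f = trans (cong (c * f zero +_) (sumF-* c (f ∘ suc)))
                           (sym (*-distribˡ-+ c (f zero) _))

sumF-swap : ∀ {m n} (f : Fin m → Fin n → ℕ) →
            sumF (λ i → sumF (f i)) ≡ sumF (λ j → sumF (λ i → f i j))
sumF-swap {zero}  {n} f = sym (sumF-zero n)
sumF-swap {suc m}     f = trans (cong (sumF (f zero) +_) (sumF-swap (f ∘ suc)))
                                (sym (sumF-+ (f zero) (λ j → sumF (λ i → f (suc i) j))))

sumF-if : ∀ {n} b (f : Fin n → ℕ) → sumF (λ i → if b then f i else 0) ≡ (if b then sumF f else 0)
sumF-if {n} true  f = refl
sumF-if {n} false f = sumF-zero n

if-∧ : ∀ a b (c : ℕ) → (if a ∧ b then c else 0) ≡ (if a then (if b then c else 0) else 0)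
if-∧ true  b c = refl
if-∧ false b c = refl

countF≡sumF : ∀ {n} (p : Fin n → Bool) → countF p ≡ sumF (λ i → if p i then 1 else 0)
countF≡sumF {zero}  p = refl
countF≡sumF {suc n} p = cong ((if p zero then 1 else 0) +_) (countF≡sumF (p ∘ suc))

countF-cong : ∀ {n} {p q : Fin n → Bool} → (∀ i → p i ≡ q i) → countF p ≡ countF q
countF-cong {zero}  p≗q = refl
countF-cong {suc n} p≗q = cong₂ _+_ (cong (λ b → if b then 1 else 0) (p≗q zero)) (countF-cong (p≗q ∘ suc))

countF-mono-≤ : ∀ {n} {p q : Fin n → Bool} → (∀ i → p i ≡ true → q i ≡ true) → countF p ≤ countF q
countF-mono-≤ {zero}            p⇒q = z≤n
countF-mono-≤ {suc n} {p} {q} p⇒q = +-mono-≤ (indicator-mono (p⇒q zero)) (countF-mono-≤ (p⇒q ∘ suc))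
  where
  indicator-mono : ∀ {a b} → (a ≡ true → b ≡ true) → (if a then 1 else 0) ≤ (if b then 1 else 0)
  indicator-mono {false} a⇒b = z≤n
  indicator-mono {true}  a⇒b rewrite a⇒b refl = ≤-refl

countF-zero : ∀ {n} (p : Fin n → Bool) → (∀ i → p i ≡ false) → countF p ≡ 0
countF-zero {zero}  p ¬p = refl
countF-zero {suc n} p ¬p rewrite ¬p zero = countF-zero (p ∘ suc) (¬p ∘ suc)

countF-pos : ∀ {n} (p : Fin n → Bool) {a} → p a ≡ true → 0 < countF p
countF-pos p {zero}  pa rewrite pa = s≤s z≤n
countF-pos p {suc a} pa = ≤-trans (countF-pos (p ∘ suc) pa) (m≤n+m _ _)

countF-split : ∀ {n} (p q : Fin n → Bool) →
               countF p ≡ countF (λ i → p i ∧ q i) + countF (λ i → p i ∧ not (q i))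
countF-split {zero}  p q = refl
countF-split {suc n} p q with p zero | q zero
... | false | _     = countF-split (p ∘ suc) (q ∘ suc)
... | true  | true  = cong suc (countF-split (p ∘ suc) (q ∘ suc))
... | true  | false = trans (cong suc (countF-split (p ∘ suc) (q ∘ suc))) (sym (+-suc _ _))

countF-∨-≤ : ∀ {n} (p q : Fin n → Bool) → countF (λ i → p i ∨ q i) ≤ countF p + countF q
countF-∨-≤ {n} p q = begin
  countF (λ i → p i ∨ q i)                  ≡⟨ countF≡sumF (λ i → p i ∨ q i) ⟩
  sumF (λ i → if p i ∨ q i then 1 else 0)   ≤⟨ sumF-mono-≤ (λ i → indicator-∨ (p i) (q i)) ⟩
  sumF (λ i → (if p i then 1 else 0) + (if q i then 1 else 0))
    ≡⟨ trans (sumF-+ (indicator ∘ p) (indicator ∘ q)) (sym (cong₂ _+_ (countF≡sumF p) (countF≡sumF q))) ⟩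
  countF p + countF q                       ∎
  where
  open ≤-Reasoning
  indicator : Bool → ℕ
  indicator b = if b then 1 else 0
  indicator-∨ : ∀ a b → (if a ∨ b then 1 else 0) ≤ (if a then 1 else 0) + (if b then 1 else 0)
  indicator-∨ true  b = s≤s z≤n
  indicator-∨ false b = ≤-refl

countF-singleton : ∀ {n} (a : Fin n) → countF (λ i → does (a ≟ i)) ≡ 1
countF-singleton {suc n} zero    = cong suc (countF-zero {n} _ (λ _ → refl))
countF-singleton {suc n} (suc a) = countF-singleton {n} a

countF-remove : ∀ {n} (p : Fin n → Bool) {a} → p a ≡ true →
                countF p ≡ suc (countF (λ i → p i ∧ not (does (a ≟ i))))
countF-remove p {a} pa = begin
  countF p                                 ≡⟨ countF-split p (λ i → does (a ≟ i)) ⟩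
  countF (λ i → p i ∧ does (a ≟ i)) + rest ≡⟨ cong (_+ rest) (countF-cong at-a) ⟩
  countF (λ i → does (a ≟ i)) + rest       ≡⟨ cong (_+ rest) (countF-singleton a) ⟩
  suc rest                                 ∎
  where
  open ≡-Reasoning
  rest : ℕ
  rest = countF (λ i → p i ∧ not (does (a ≟ i)))
  at-a : ∀ i → (p i ∧ does (a ≟ i)) ≡ does (a ≟ i)
  at-a i with a ≟ i
  ... | yes refl = trans (∧-identityʳ (p a)) pa
  ... | no  _    = ∧-zeroʳ (p i)

countF-unique : ∀ {n} (p : Fin n → Bool) {a} → p a ≡ true → (∀ i → p i ≡ true → i ≡ a) → countF p ≡ 1
countF-unique p {a} pa unique = trans (countF-remove p pa) (cong suc (countF-zero _ others))
  where
  others : ∀ i → (p i ∧ not (does (a ≟ i))) ≡ false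
  others i with p i in pi | a ≟ i
  ... | false | _       = refl
  ... | true  | yes _   = refl
  ... | true  | no  a≢i = ⊥-elim (a≢i (sym (unique i pi)))

countF-insert : ∀ {n} (p : Fin n → Bool) {a} → p a ≡ false → countF (λ i → does (a ≟ i) ∨ p i) ≡ suc (countF p)
countF-insert p {a} ¬pa = trans (countF-remove (λ i → does (a ≟ i) ∨ p i) a∈) (cong suc (countF-cong drop-a))
  where
  a∈ : (does (a ≟ a) ∨ p a) ≡ true
  a∈ with a ≟ a
  ... | yes _   = refl
  ... | no  a≢a = ⊥-elim (a≢a refl)
  drop-a : ∀ i → ((does (a ≟ i) ∨ p i) ∧ not (does (a ≟ i))) ≡ p i
  drop-a i with a ≟ i
  ... | yes refl = sym ¬pa
  ... | no  _    = ∧-identityʳ (p i)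

dec-true⁻¹ : ∀ {a} {A : Set a} (a? : Dec A) → does a? ≡ true → A
dec-true⁻¹ (yes a) _ = a

allF-sound : ∀ {n} (p : Fin n → Bool) → allF p ≡ true → ∀ i → p i ≡ true
allF-sound p all zero    with p zero
... | true = refl
allF-sound p ()  zero    | false
allF-sound p all (suc i) with p zero
... | true = allF-sound (p ∘ suc) all i
allF-sound p ()  (suc i) | false

allF-complete : ∀ {n} (p : Fin n → Bool) → (∀ i → p i ≡ true) → allF p ≡ true
allF-complete {zero}  p all = refl
allF-complete {suc n} p all rewrite all zero = allF-complete (p ∘ suc) (all ∘ suc)

∣tabulate∣≡countF : ∀ {n} (p : Fin n → Bool) → ∣ tabulate p ∣ ≡ countF p
∣tabulate∣≡countF {zero}  p = refl
∣tabulate∣≡countF {suc n} p with p zero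
... | true  = cong suc (∣tabulate∣≡countF (p ∘ suc))
... | false = ∣tabulate∣≡countF (p ∘ suc)

∈tabulate⁻ : ∀ {n} {p : Fin n → Bool} {i} → i ∈ tabulate p → p i ≡ true
∈tabulate⁻ {p = p} {i} i∈ = trans (sym (lookup∘tabulate p i)) ([]=⇒lookup i∈)

∈tabulate⁺ : ∀ {n} {p : Fin n → Bool} {i} → p i ≡ true → i ∈ tabulate p
∈tabulate⁺ {p = p} {i} pi = lookup⇒[]= i (tabulate p) (trans (lookup∘tabulate p i) pi)

strictUpper : ∀ {n} → (Fin n → Fin n → ℕ) → Fin n → Fin n → ℕ
strictUpper f x y = if toℕ x <ᵇ toℕ y then f x y else 0

offDiagonal : ∀ {n} → (Fin n → Fin n → ℕ) → Fin n → Fin n → ℕ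
offDiagonal f x y = if does (x ≟ y) then 0 else f x y

Symmetric : ∀ {n} → (Fin n → Fin n → ℕ) → Set
Symmetric f = ∀ x y → f x y ≡ f y x

strictUpper-+-transpose : ∀ {n} {f : Fin n → Fin n → ℕ} → Symmetric f → ∀ x y →
                          strictUpper f x y + strictUpper f y x ≡ offDiagonal f x y
strictUpper-+-transpose {f = f} f-sym x y
  with x ≟ y | toℕ x <ᵇ toℕ y | <ᵇ-reflects-< (toℕ x) (toℕ y)
             | toℕ y <ᵇ toℕ x | <ᵇ-reflects-< (toℕ y) (toℕ x)
... | yes refl | _ | ofʸ x<x | _ | _      = ⊥-elim (<-irrefl refl x<x)
... | yes refl | _ | ofⁿ _   | _ | ofʸ x<x = ⊥-elim (<-irrefl refl x<x)
... | yes refl | _ | ofⁿ _   | _ | ofⁿ _   = refl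
... | no _ | _ | ofʸ x<y | _ | ofʸ y<x = ⊥-elim (<-asym x<y y<x)
... | no _ | _ | ofʸ _   | _ | ofⁿ _   = +-identityʳ (f x y)
... | no _ | _ | ofⁿ _   | _ | ofʸ _   = f-sym y x
... | no x≢y | _ | ofⁿ x≮y | _ | ofⁿ y≮x =
  ⊥-elim (x≢y (toℕ-injective (≤-antisym (≮⇒≥ y≮x) (≮⇒≥ x≮y))))

sumF²-offDiagonal : ∀ {n} {f : Fin n → Fin n → ℕ} → Symmetric f →
  sumF (λ x → sumF (offDiagonal f x)) ≡ 2 * sumF (λ x → sumF (strictUpper f x))
sumF²-offDiagonal {f = f} f-sym = begin
  sumF (λ x → sumF (offDiagonal f x))
    ≡⟨ sumF-cong (λ x → sumF-cong (λ y → sym (strictUpper-+-transpose f-sym x y))) ⟩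
  sumF (λ x → sumF (λ y → strictUpper f x y + strictUpper f y x))
    ≡⟨ sumF-cong (λ x → sumF-+ (strictUpper f x) (λ y → strictUpper f y x)) ⟩
  sumF (λ x → sumF (strictUpper f x) + sumF (λ y → strictUpper f y x))
    ≡⟨ sumF-+ (λ x → sumF (strictUpper f x)) (λ x → sumF (λ y → strictUpper f y x)) ⟩
  U + sumF (λ x → sumF (λ y → strictUpper f y x))
    ≡⟨ cong (U +_) (sym (sumF-swap (strictUpper f))) ⟩
  U + U
    ≡⟨ cong (U +_) (sym (+-identityʳ U)) ⟩
  2 * U ∎
  where
  open ≡-Reasoning
  U : ℕ
  U = sumF (λ x → sumF (strictUpper f x))

-- Neighbourhood sums

module _ {n : ℕ} (G : Graph n) where
  open Graph G renaming (sym to adj-sym)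

  adj⇒≢ : ∀ {x y} → adj x y ≡ true → x ≢ y
  adj⇒≢ {x} xy refl with () ← trans (sym xy) (irrefl x)

  w-sym : Symmetric (w G)
  w-sym x y = countF-cong (λ z → ∧-comm (adj x z) (adj y z))

  sumN : Fin n → (Fin n → ℕ) → ℕ
  sumN x f = sumF (λ u → if adj x u then f u else 0)

  sumN-cong : ∀ x {f g : Fin n → ℕ} → (∀ u → adj x u ≡ true → f u ≡ g u) → sumN x f ≡ sumN x g
  sumN-cong x {f} {g} f≗g = sumF-cong pointwise
    where
    pointwise : ∀ u → (if adj x u then f u else 0) ≡ (if adj x u then g u else 0)
    pointwise u with adj x u in xu
    ... | true  = f≗g u xu
    ... | false = refl

  sumN-mono-≤ : ∀ x {f g : Fin n → ℕ} → (∀ u → adj x u ≡ true → f u ≤ g u) → sumN x f ≤ sumN x g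
  sumN-mono-≤ x {f} {g} f≤g = sumF-mono-≤ pointwise
    where
    pointwise : ∀ u → (if adj x u then f u else 0) ≤ (if adj x u then g u else 0)
    pointwise u with adj x u in xu
    ... | true  = f≤g u xu
    ... | false = z≤n

  sumN-+ : ∀ x (f g : Fin n → ℕ) → sumN x (λ u → f u + g u) ≡ sumN x f + sumN x g
  sumN-+ x f g = trans (sumF-cong pointwise)
                       (sumF-+ (λ u → if adj x u then f u else 0) (λ u → if adj x u then g u else 0))
    where
    pointwise : ∀ u → (if adj x u then f u + g u else 0)
                      ≡ (if adj x u then f u else 0) + (if adj x u then g u else 0)
    pointwise u with adj x u
    ... | true  = refl
    ... | false = refl

  sumN-const : ∀ x c → sumN x (λ _ → c) ≡ c * deg G x
  sumN-const x c = begin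
    sumF (λ u → if adj x u then c else 0)       ≡⟨ sumF-cong (λ u → if-const (adj x u)) ⟩
    sumF (λ u → c * (if adj x u then 1 else 0)) ≡⟨ sumF-* c (λ u → if adj x u then 1 else 0) ⟩
    c * sumF (λ u → if adj x u then 1 else 0)   ≡⟨ cong (c *_) (sym (countF≡sumF (adj x))) ⟩
    c * deg G x                                 ∎
    where
    open ≡-Reasoning
    if-const : ∀ b → (if b then c else 0) ≡ c * (if b then 1 else 0)
    if-const true  = sym (*-identityʳ c)
    if-const false = sym (*-zeroʳ c)

  handshake : ∀ (f : Fin n → Fin n → ℕ) → Symmetric f →
    sumF (λ x → sumN x (f x)) ≡ 2 * sumF (λ x → sumF (λ y → if isEdge< G x y then f x y else 0))
  handshake f f-sym = begin
    sumF (λ x → sumF (F x))                 ≡⟨ sumF-cong (λ x → sumF-cong (offDiagonal-F x)) ⟩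
    sumF (λ x → sumF (offDiagonal F x))     ≡⟨ sumF²-offDiagonal F-sym ⟩
    2 * sumF (λ x → sumF (strictUpper F x)) ≡⟨ cong (2 *_) (sumF-cong (λ x → sumF-cong (λ y →
                                                 sym (if-∧ (toℕ x <ᵇ toℕ y) (adj x y) (f x y))))) ⟩
    2 * sumF (λ x → sumF (λ y → if isEdge< G x y then f x y else 0)) ∎
    where
    open ≡-Reasoning
    F : Fin n → Fin n → ℕ
    F x y = if adj x y then f x y else 0
    F-sym : Symmetric F
    F-sym x y rewrite adj-sym x y | f-sym x y = refl
    offDiagonal-F : ∀ x y → F x y ≡ offDiagonal F x y
    offDiagonal-F x y with x ≟ y
    ... | yes refl rewrite irrefl x = refl
    ... | no  _    = refl

  sumF-deg : sumF (deg G) ≡ 2 * numEdges G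
  sumF-deg = begin
    sumF (deg G)                    ≡⟨ sumF-cong (λ x → countF≡sumF (adj x)) ⟩
    sumF (λ x → sumN x (λ _ → 1))   ≡⟨ handshake (λ _ _ → 1) (λ _ _ → refl) ⟩
    2 * sumF (λ x → sumF (λ y → if isEdge< G x y then 1 else 0))
      ≡⟨ cong (2 *_) (sumF-cong (λ x → sym (countF≡sumF (isEdge< G x)))) ⟩
    2 * numEdges G                  ∎
    where open ≡-Reasoning

  exclusive : Fin n → Fin n → ℕ
  exclusive x y = countF (λ z → adj x z ∧ not (adj y z))

  deg≡w+exclusive : ∀ x y → deg G x ≡ w G x y + exclusive x y
  deg≡w+exclusive x y = countF-split (adj x) (adj y)

  w<deg : ∀ {x y} → adj x y ≡ true → w G x y < deg G x
  w<deg {x} {y} xy = begin-strict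
    w G x y                 <⟨ m<m+n (w G x y) (countF-pos (λ z → adj x z ∧ not (adj y z)) y∈) ⟩
    w G x y + exclusive x y ≡⟨ sym (deg≡w+exclusive x y) ⟩
    deg G x                 ∎
    where
    open ≤-Reasoning
    y∈ : (adj x y ∧ not (adj y y)) ≡ true
    y∈ rewrite xy | irrefl y = refl

  Twin : Fin n → Fin n → Set
  Twin a b = ∀ z → z ≢ a → z ≢ b → adj a z ≡ adj b z

  twin-trans : ∀ {x a b} → Twin x a → Twin x b → adj x a ≡ true → adj x b ≡ true → a ≢ b →
               adj a b ≡ true × Twin a b
  twin-trans {x} {a} {b} x~a x~b xa xb a≢b = ab , a~b
    where
    ab : adj a b ≡ true
    ab = trans (sym (x~a b (adj⇒≢ (trans (adj-sym b x) xb)) (a≢b ∘ sym))) xb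
    a~b : Twin a b
    a~b z z≢a z≢b with z ≟ x
    ... | yes refl = trans (adj-sym a z) (trans xa (trans (sym xb) (adj-sym z b)))
    ... | no  z≢x  = trans (sym (x~a z z≢x z≢a)) (x~b z z≢x z≢b)

  missingFrom : Fin n → Fin n → Fin n → Bool
  missingFrom x u v = (adj x v ∧ not (does (u ≟ v))) ∧ not (adj u v)

  missing : Fin n → Fin n → ℕ
  missing x u = countF (missingFrom x u)

  suc-w+missing : ∀ {x u} → adj x u ≡ true → suc (w G x u + missing x u) ≡ deg G x
  suc-w+missing {x} {u} xu = sym (begin
    countF (adj x)                            ≡⟨ countF-remove (adj x) xu ⟩
    suc (countF N∖u)                          ≡⟨ cong suc (countF-split N∖u (adj u)) ⟩
    suc (countF (λ v → N∖u v ∧ adj u v) + missing x u)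
                                              ≡⟨ cong (λ k → suc (k + missing x u)) (countF-cong common) ⟩
    suc (w G x u + missing x u)               ∎)
    where
    open ≡-Reasoning
    N∖u : Fin n → Bool
    N∖u v = adj x v ∧ not (does (u ≟ v))
    common : ∀ v → (N∖u v ∧ adj u v) ≡ (adj x v ∧ adj u v)
    common v with u ≟ v
    ... | yes refl rewrite irrefl u = trans (∧-zeroʳ _) (sym (∧-zeroʳ (adj x u)))
    ... | no  _    = cong (_∧ adj u v) (∧-identityʳ (adj x v))

  missingPairs : Fin n → ℕ
  missingPairs x = sumN x (missing x)

  sumN-w+2+missingPairs : ∀ x →
    sumN x (λ u → w G x u + 2) + missingPairs x ≡ deg G x + deg G x * deg G x
  sumN-w+2+missingPairs x = begin
    sumN x (λ u → w G x u + 2) + missingPairs x  ≡⟨ sym (sumN-+ x (λ u → w G x u + 2) (missing x)) ⟩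
    sumN x (λ u → w G x u + 2 + missing x u)     ≡⟨ sumN-cong x (λ u xu →
                                                      trans (w+2+m (w G x u) (missing x u)) (cong suc (suc-w+missing xu))) ⟩
    sumN x (λ _ → suc (deg G x))                 ≡⟨ sumN-const x (suc (deg G x)) ⟩
    deg G x + deg G x * deg G x                  ∎
    where
    open ≡-Reasoning
    w+2+m : ∀ a b → a + 2 + b ≡ suc (suc (a + b))
    w+2+m a b = trans (+-assoc a 2 b) (trans (+-suc a (suc b)) (cong suc (+-suc a b)))

  inS⇒adj : ∀ {T x v} → x ∈ T → inS G T v ≡ true → adj x v ≡ true
  inS⇒adj {T} {x} {v} x∈T v∈S with allF-sound _ v∈S x
  ... | x~v rewrite []=⇒lookup x∈T = x~v

  2*eR≤missingPairs : ∀ {T x} → x ∈ T → 2 * eR G T ≤ missingPairs x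
  2*eR≤missingPairs {T} {x} x∈T = begin
    2 * eR G T                                ≡⟨ cong (2 *_) eR≡strictUpper ⟩
    2 * sumF (λ u → sumF (strictUpper R u))   ≡⟨ sym (sumF²-offDiagonal R-sym) ⟩
    sumF (λ u → sumF (offDiagonal R u))       ≤⟨ sumF-mono-≤ (λ u → sumF-mono-≤ (offDiagonal-R≤ u)) ⟩
    sumF (λ u → sumF (λ v → if adj x u then (if missingFrom x u v then 1 else 0) else 0))
      ≡⟨ sumF-cong (λ u → trans (sumF-if (adj x u) (λ v → if missingFrom x u v then 1 else 0))
                                (cong (λ k → if adj x u then k else 0) (sym (countF≡sumF (missingFrom x u))))) ⟩
    missingPairs x                            ∎
    where
    open ≤-Reasoning
    R : Fin n → Fin n → ℕ
    R u v = if inS G T u ∧ inS G T v ∧ not (adj u v) then 1 else 0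
    R-sym : Symmetric R
    R-sym u v rewrite adj-sym u v with inS G T u | inS G T v
    ... | true  | true  = refl
    ... | true  | false = refl
    ... | false | true  = refl
    ... | false | false = refl
    eR≡strictUpper : eR G T ≡ sumF (λ u → sumF (strictUpper R u))
    eR≡strictUpper = sumF-cong (λ u →
      trans (countF≡sumF (λ v → (toℕ u <ᵇ toℕ v) ∧ inS G T u ∧ inS G T v ∧ not (adj u v)))
            (sumF-cong (λ v → if-∧ (toℕ u <ᵇ toℕ v) (inS G T u ∧ inS G T v ∧ not (adj u v)) 1)))
    offDiagonal-R≤ : ∀ u v → offDiagonal R u v ≤ (if adj x u then (if missingFrom x u v then 1 else 0) else 0)
    offDiagonal-R≤ u v with u ≟ v
    ... | yes _ = z≤n
    ... | no  _ with inS G T u in u∈S | inS G T v in v∈S | adj u v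
    ... | false | _     | _     = z≤n
    ... | true  | false | _     = z≤n
    ... | true  | true  | true  = z≤n
    ... | true  | true  | false rewrite inS⇒adj x∈T u∈S | inS⇒adj x∈T v∈S = ≤-refl

  sumF-sumN-w+2 : sumF (λ x → sumN x (λ u → w G x u + 2)) ≡ 2 * (sumW G + 2 * numEdges G)
  sumF-sumN-w+2 = begin
    sumF (λ x → sumN x (λ u → w G x u + 2))
      ≡⟨ sumF-cong (λ x → trans (sumN-+ x (w G x) (λ _ → 2)) (cong (sumN x (w G x) +_) (sumN-const x 2))) ⟩
    sumF (λ x → sumN x (w G x) + 2 * deg G x)
      ≡⟨ sumF-+ (λ x → sumN x (w G x)) (λ x → 2 * deg G x) ⟩
    sumF (λ x → sumN x (w G x)) + sumF (λ x → 2 * deg G x)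
      ≡⟨ cong₂ _+_ (handshake (w G) w-sym) (trans (sumF-* 2 (deg G)) (cong (2 *_) sumF-deg)) ⟩
    2 * sumW G + 2 * (2 * numEdges G)
      ≡⟨ sym (*-distribˡ-+ 2 (sumW G) (2 * numEdges G)) ⟩
    2 * (sumW G + 2 * numEdges G) ∎
    where open ≡-Reasoning

  sumF-*-deg : ∀ c → sumF (λ x → c * deg G x) ≡ 2 * (c * numEdges G)
  sumF-*-deg c = begin
    sumF (λ x → c * deg G x) ≡⟨ sumF-* c (deg G) ⟩
    c * sumF (deg G)         ≡⟨ cong (c *_) sumF-deg ⟩
    c * (2 * numEdges G)     ≡⟨ *-comm-middle ⟩
    2 * (c * numEdges G)     ∎
    where
    open ≡-Reasoning
    *-comm-middle : c * (2 * numEdges G) ≡ 2 * (c * numEdges G)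
    *-comm-middle = trans (sym (*-assoc c 2 (numEdges G)))
                          (trans (cong (_* numEdges G) (*-comm c 2)) (*-assoc 2 c (numEdges G)))

-- Tight edges and clusters

-- The degree bound r is written suc k, so that tight edges are those with w = k.
module Tightness {n : ℕ} (G : Graph n) (k : ℕ) (Δ≤1+k : MaxDegreeAtMost G (suc k)) where
  open Graph G renaming (sym to adj-sym)

  tight? : ∀ x y → Dec (Tight G (suc k) x y)
  tight? x y = (adj x y Bool.≟ true) ×-dec (w G x y ≟ℕ k)

  tight-sym : ∀ {x y} → Tight G (suc k) x y → Tight G (suc k) y x
  tight-sym {x} {y} (xy , w≡k) = trans (adj-sym y x) xy , trans (w-sym G y x) w≡k

  tight⇒deg≡1+k : ∀ {x y} → Tight G (suc k) x y → deg G x ≡ suc k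
  tight⇒deg≡1+k {x} (xy , w≡k) = ≤-antisym (Δ≤1+k x) (subst (λ m → suc m ≤ deg G x) w≡k (w<deg G xy))

  tight⇒exclusive≤1 : ∀ {x y} → Tight G (suc k) x y → exclusive G x y ≤ 1
  tight⇒exclusive≤1 {x} {y} (xy , w≡k) = +-cancelˡ-≤ k (exclusive G x y) 1 (begin
    k + exclusive G x y       ≡⟨ cong (_+ exclusive G x y) (sym w≡k) ⟩
    w G x y + exclusive G x y ≡⟨ sym (deg≡w+exclusive G x y) ⟩
    deg G x                   ≤⟨ Δ≤1+k x ⟩
    suc k                     ≡⟨ +-comm 1 k ⟩
    k + 1                     ∎)
    where open ≤-Reasoning

  tight⇒N⊆N : ∀ {x y} → Tight G (suc k) x y → ∀ {z} → z ≢ y → adj x z ≡ true → adj y z ≡ true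
  tight⇒N⊆N {x} {y} t@(xy , _) {z} z≢y xz with adj y z in yz
  ... | true  = refl
  ... | false = contradiction (tight⇒exclusive≤1 t) (<⇒≱ (begin-strict
    1                                                <⟨ s≤s (countF-pos (λ v → excl v ∧ not (does (y ≟ v))) z∈) ⟩
    suc (countF (λ v → excl v ∧ not (does (y ≟ v)))) ≡⟨ sym (countF-remove excl y∈) ⟩
    exclusive G x y                                  ∎))
    where
    open ≤-Reasoning
    excl : Fin n → Bool
    excl v = adj x v ∧ not (adj y v)
    y∈ : excl y ≡ true
    y∈ rewrite xy | irrefl y = refl
    z∈ : (excl z ∧ not (does (y ≟ z))) ≡ true
    z∈ with y ≟ z
    ... | yes y≡z = contradiction (sym y≡z) z≢y
    ... | no  _   rewrite xz | yz = refl

  tight⇒twin : ∀ {x y} → Tight G (suc k) x y → Twin G x y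
  tight⇒twin {x} {y} t z z≢x z≢y with adj x z in xz | adj y z in yz
  ... | true  | true  = refl
  ... | false | false = refl
  ... | true  | false = contradiction (trans (sym yz) (tight⇒N⊆N t z≢y xz)) λ ()
  ... | false | true  = contradiction (trans (sym xz) (tight⇒N⊆N (tight-sym t) z≢x yz)) λ ()

  twin⇒tight : ∀ {a b} → adj a b ≡ true → Twin G a b → deg G a ≡ suc k → Tight G (suc k) a b
  twin⇒tight {a} {b} ab a~b deg≡1+k = ab , suc-injective (begin
    suc (w G a b)             ≡⟨ +-comm 1 (w G a b) ⟩
    w G a b + 1               ≡⟨ cong (w G a b +_) (sym exclusive≡1) ⟩
    w G a b + exclusive G a b ≡⟨ sym (deg≡w+exclusive G a b) ⟩
    deg G a                   ≡⟨ deg≡1+k ⟩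
    suc k                     ∎)
    where
    open ≡-Reasoning
    only-b : ∀ v → (adj a v ∧ not (adj b v)) ≡ true → v ≡ b
    only-b v v∈ with v ≟ b
    ... | yes v≡b = v≡b
    ... | no  v≢b with v ≟ a
    ... | yes refl = contradiction (trans (sym (cong (_∧ not (adj b a)) (irrefl a))) v∈) λ ()
    ... | no  v≢a rewrite a~b v v≢a v≢b with adj b v
    ... | true  = contradiction v∈ λ ()
    ... | false = contradiction v∈ λ ()
    exclusive≡1 : exclusive G a b ≡ 1
    exclusive≡1 = countF-unique (λ v → adj a v ∧ not (adj b v)) b∈ only-b
      where
      b∈ : (adj a b ∧ not (adj b b)) ≡ true
      b∈ rewrite ab | irrefl b = refl

  tightClass : Fin n → Subset n
  tightClass x = tabulate (λ z → does (x ≟ z) ∨ does (tight? x z))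

  ∈tightClass⁻ : ∀ {x z} → z ∈ tightClass x → x ≡ z ⊎ Tight G (suc k) x z
  ∈tightClass⁻ {x} {z} z∈ with x ≟ z | ∈tabulate⁻ z∈
  ... | yes x≡z | _        = inj₁ x≡z
  ... | no  _   | tight-xz = inj₂ (dec-true⁻¹ (tight? x z) tight-xz)

  ∈tightClass⁺ : ∀ {x z} → x ≡ z ⊎ Tight G (suc k) x z → z ∈ tightClass x
  ∈tightClass⁺ {x} (inj₁ refl) = ∈tabulate⁺ (cong (_∨ does (tight? x x)) (dec-true (x ≟ x) refl))
  ∈tightClass⁺ {x} {z} (inj₂ t) = ∈tabulate⁺ (trans (cong (does (x ≟ z) ∨_) (dec-true (tight? x z) t))
                                                    (∨-zeroʳ (does (x ≟ z))))

  ∣tightClass∣ : ∀ x → ∣ tightClass x ∣ ≡ suc (countF (λ z → does (tight? x z)))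
  ∣tightClass∣ x = trans (∣tabulate∣≡countF (λ z → does (x ≟ z) ∨ does (tight? x z)))
                         (countF-insert (λ z → does (tight? x z)) x≁x)
    where
    x≁x : does (tight? x x) ≡ false
    x≁x = dec-false (tight? x x) λ (xx , _) → contradiction (trans (sym (irrefl x)) xx) λ ()

  tightClass-isTightClique : ∀ x → TightClique G (suc k) (tightClass x)
  tightClass-isTightClique x a b a∈ b∈ a≢b with ∈tightClass⁻ a∈ | ∈tightClass⁻ b∈
  ... | inj₁ refl | inj₁ refl = contradiction refl a≢b
  ... | inj₁ refl | inj₂ t    = t
  ... | inj₂ t    | inj₁ refl = tight-sym t
  ... | inj₂ xa   | inj₂ xb   =
    let ab , a~b = twin-trans G (tight⇒twin xa) (tight⇒twin xb) (proj₁ xa) (proj₁ xb) a≢b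
    in  twin⇒tight ab a~b (tight⇒deg≡1+k (tight-sym xa))

  tightClass-maximal : ∀ x T′ → TightClique G (suc k) T′ → tightClass x ⊆ T′ → T′ ⊆ tightClass x
  tightClass-maximal x T′ clique T⊆T′ {z} z∈T′ with x ≟ z
  ... | yes x≡z = ∈tightClass⁺ (inj₁ x≡z)
  ... | no  x≢z = ∈tightClass⁺ (inj₂ (clique x z (T⊆T′ (∈tightClass⁺ (inj₁ refl))) z∈T′ x≢z))

  tightClass-isCluster : ∀ {x y} → Tight G (suc k) x y → Cluster G (suc k) (tightClass x)
  tightClass-isCluster {x} {y} xy = tightClass-isTightClique x , tightClass-maximal x , (begin
    2                                      ≤⟨ s≤s (countF-pos (λ z → does (tight? x z)) (dec-true (tight? x y) xy)) ⟩
    suc (countF (λ z → does (tight? x z))) ≡⟨ sym (∣tightClass∣ x) ⟩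
    ∣ tightClass x ∣                       ∎)
    where open ≤-Reasoning

  -- N(x) is covered by the common neighbourhood S of the class and the class minus x.
  deg≤|S|+|T|∸1 : ∀ x → deg G x ≤ sSize G (tightClass x) + ∣ tightClass x ∣ ∸ 1
  deg≤|S|+|T|∸1 x = begin
    countF (adj x)                                   ≤⟨ countF-mono-≤ covered ⟩
    countF (λ v → inS G T v ∨ does (tight? x v))     ≤⟨ countF-∨-≤ (inS G T) (λ v → does (tight? x v)) ⟩
    sSize G T + countF (λ v → does (tight? x v))
      ≡⟨ sym (cong (_∸ 1) (trans (cong (sSize G T +_) (∣tightClass∣ x)) (+-suc _ _))) ⟩
    sSize G T + ∣ T ∣ ∸ 1                            ∎
    where
    open ≤-Reasoning
    T : Subset n
    T = tightClass x
    covered : ∀ v → adj x v ≡ true → (inS G T v ∨ does (tight? x v)) ≡ true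
    covered v xv with tight? x v
    ... | yes xv-tight = trans (cong (inS G T v ∨_) (dec-true (tight? x v) xv-tight)) (∨-zeroʳ (inS G T v))
    ... | no  ¬xv      = trans (cong (inS G T v ∨_) (dec-false (tight? x v) ¬xv))
                               (trans (∨-identityʳ (inS G T v)) (allF-complete _ adjacent-to-class))
      where
      adjacent-to-class : ∀ a → (not (lookup T a) ∨ adj a v) ≡ true
      adjacent-to-class a with lookup T a in a∈
      ... | false = refl
      ... | true with ∈tightClass⁻ (lookup⇒[]= a T a∈)
      ... | inj₁ refl = xv
      ... | inj₂ xa   = trans (sym (tight⇒twin xa v (adj⇒≢ G xv ∘ sym) v≢a)) xv
        where
        v≢a : v ≢ a
        v≢a refl = ¬xv xa

  dischargeable⇒deg≤missingPairs : ∀ x → Dischargeable G (tightClass x) → deg G x ≤ missingPairs G x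
  dischargeable⇒deg≤missingPairs x discharge = begin
    deg G x                                       ≤⟨ deg≤|S|+|T|∸1 x ⟩
    sSize G (tightClass x) + ∣ tightClass x ∣ ∸ 1 ≤⟨ discharge ⟩
    2 * eR G (tightClass x)                       ≤⟨ 2*eR≤missingPairs G (∈tightClass⁺ (inj₁ refl)) ⟩
    missingPairs G x                              ∎
    where open ≤-Reasoning

  looseVertexBound : ∀ x → (∀ y → ¬ Tight G (suc k) x y) →
                     sumN G x (λ u → w G x u + 2) ≤ suc k * deg G x
  looseVertexBound x loose = begin
    sumN G x (λ u → w G x u + 2) ≤⟨ sumN-mono-≤ G x w+2≤1+k ⟩
    sumN G x (λ _ → suc k)       ≡⟨ sumN-const G x (suc k) ⟩
    suc k * deg G x              ∎
    where
    open ≤-Reasoning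
    w+2≤1+k : ∀ u → adj x u ≡ true → w G x u + 2 ≤ suc k
    w+2≤1+k u xu = subst (_≤ suc k) (+-comm 2 (w G x u))
      (s≤s (≤∧≢⇒< (≤-pred (≤-trans (w<deg G xu) (Δ≤1+k x))) (λ w≡k → loose u (xu , w≡k))))

  tightVertexBound : ∀ {x y} → Tight G (suc k) x y → deg G x ≤ missingPairs G x →
                     sumN G x (λ u → w G x u + 2) ≤ suc k * deg G x
  tightVertexBound {x} xy d≤m = begin
    sumN G x (λ u → w G x u + 2)  ≤⟨ +-cancelʳ-≤ d _ (d * d) (begin
        sumN G x (λ u → w G x u + 2) + d                ≤⟨ +-monoʳ-≤ _ d≤m ⟩
        sumN G x (λ u → w G x u + 2) + missingPairs G x ≡⟨ sumN-w+2+missingPairs G x ⟩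
        d + d * d                                       ≡⟨ +-comm d (d * d) ⟩
        d * d + d                                       ∎) ⟩
    d * d                         ≡⟨ cong (_* d) (tight⇒deg≡1+k xy) ⟩
    suc k * d                     ∎
    where
    open ≤-Reasoning
    d : ℕ
    d = deg G x

  vertexBound : (∀ T → Cluster G (suc k) T → Dischargeable G T) →
                ∀ x → sumN G x (λ u → w G x u + 2) ≤ suc k * deg G x
  vertexBound discharge x with any? (tight? x)
  ... | yes (y , xy) = tightVertexBound xy
                         (dischargeable⇒deg≤missingPairs x (discharge _ (tightClass-isCluster xy)))
  ... | no  ¬∃      = looseVertexBound x (λ y xy → ¬∃ (y , xy))

open Tightness using (vertexBound)

-- The edge hypothesis only makes the average meaningful; the cleared form holds for every graph.
mainTheorem7 : ∀ {n : ℕ} (G : Graph n) (r : ℕ) → 1 ≤ r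
    → HasEdge G → MaxDegreeAtMost G r
    → (∀ (T : Subset n) → Cluster G r T → Dischargeable G T)
    → sumW G + 2 * numEdges G ≤ r * numEdges G
mainTheorem7 G (suc k) _ _ Δ≤r discharge = *-cancelˡ-≤ 2 (begin
  2 * (sumW G + 2 * numEdges G)             ≡⟨ sym (sumF-sumN-w+2 G) ⟩
  sumF (λ x → sumN G x (λ u → w G x u + 2)) ≤⟨ sumF-mono-≤ (vertexBound G k Δ≤r discharge) ⟩
  sumF (λ x → suc k * deg G x)              ≡⟨ sumF-*-deg G (suc k) ⟩
  2 * (suc k * numEdges G)                  ∎)
  where open ≤-Reasoning
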